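{- For all integers $k\geq 2$ and $r\geq 0$, $$\mathrm{Peak}_k^r(x)=\mathrm{Valley}_{k-2}^r(x).$$ Equivalently, for every $n\geq 0$, the number of Dyck paths from $(0,0)$ to $(2n,0)$ with exactly $r$ peaks at height $k$ equals the number of Dyck paths from $(0,0)$ to $(2n,0)$ with exactly $r$ valleys at height $k-2$.
   Context: A Dyck path is a lattice path in $\mathbb{Z}\times\mathbb{Z}$ consisting of up-steps $(1,1)$ and down-steps $(1,-1)$ that never passes below the $x$-axis. A peak at height $k$ is a point of the path with $y$-coordinate $k$ that is immediately preceded by an up-step and immediately followed by a down-step. A valley at height $k$ is a point of the path with $y$-coordinate $k$ that is immediately preceded by a down-step and immediately followed by an up-step. Let $\mathrm{peak}_k^r(n)$ (resp. $\mathrm{valley}_k^r(n)$) be the number of Dyck paths starting at $(0,0)$ and ending at $(2n,0)$ with exactly $r$ peaks (resp. valleys) at height $k$, and let $\mathrm{Peak}_k^r(x)=\sum_{n\geq0}\mathrm{peak}_k^r(n)x^n$ and $\mathrm{Valley}_k^r(x)=\sum_{n\geq0}\mathrm{valley}_k^r(n)x^n$ (the empty path, $n=0$, is included). -}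

module Defs where

open import Data.Nat using (ℕ; zero; suc; _+_; _≡ᵇ_)
open import Data.Bool using (Bool; true; false; if_then_else_; _∧_)
open import Data.List using (List; []; _∷_; length; filter; map; _++_)
open import Data.Maybe using (Maybe; just; nothing)
open import Relation.Binary.PropositionalEquality using (_≡_)

-- A step: true = up-step (1,1), false = down-step (1,-1).
Step : Set
Step = Bool

U D : Step
U = true
D = false

walk : ℕ → List Step → Maybe ℕ
walk h []            = just h
walk h (true  ∷ s)   = walk (suc h) s
walk zero (false ∷ s) = nothing
walk (suc h) (false ∷ s) = walk h s

isDyck : List Step → Bool
isDyck s with walk 0 s
... | just zero = true
... | _         = false

allSeqs : ℕ → List (List Step)
allSeqs zero    = [] ∷ []
allSeqs (suc m) = map (true ∷_) (allSeqs m) ++ map (false ∷_) (allSeqs m)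

dyckPaths : ℕ → List (List Step)
dyckPaths n = filter (λ s → isDyck s Data.Bool.≟ true) (allSeqs (n + n))
  where import Data.Bool

-- Number of peaks at height k: points at height k preceded by U and followed by D.
-- h is the current height (before the head step).
peaksAt : ℕ → ℕ → List Step → ℕ
peaksAt k h (true ∷ false ∷ s) =
  (if suc h ≡ᵇ k then 1 else 0) + peaksAt k (suc h) (false ∷ s)
peaksAt k h (true ∷ s)         = peaksAt k (suc h) s
peaksAt k h (false ∷ s)        = peaksAt k (h Data.Nat.∸ 1) s
peaksAt k h []                 = 0

valleysAt : ℕ → ℕ → List Step → ℕ
valleysAt k h (false ∷ true ∷ s) =
  (if (h Data.Nat.∸ 1) ≡ᵇ k then 1 else 0) + valleysAt k (h Data.Nat.∸ 1) (true ∷ s)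
valleysAt k h (false ∷ s)        = valleysAt k (h Data.Nat.∸ 1) s
valleysAt k h (true ∷ s)         = valleysAt k (suc h) s
valleysAt k h []                 = 0

peak : ℕ → ℕ → ℕ → ℕ
peak k r n = length (filter (λ s → peaksAt k 0 s Data.Nat.≟ r) (dyckPaths n))

valley : ℕ → ℕ → ℕ → ℕ
valley k r n = length (filter (λ s → valleysAt k 0 s Data.Nat.≟ r) (dyckPaths n))

{-# OPTIONS --safe #-}
module Submission where

-- At height j+1 the factor UD (a peak at height j+2) and the factor DU (a valley
-- at height j) both return to height j+1.  Scanning a step sequence from left to
-- right and exchanging every such factor met at height j+1 therefore leaves all
-- other heights unchanged: it keeps Dyck paths Dyck and turns peaks at height j+2
-- into valleys at height j.  It also permutes the step sequences of each length
-- (after the first two steps at height j+1 it only exchanges the UD- and DU-blocks),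
-- so summing over all sequences is invariant under it.

open import Defs
open import Data.Nat using (ℕ; _+_; _≤_)
open import Relation.Binary.PropositionalEquality using (_≡_)

open import Function using (_∘_)
open import Data.Nat using (zero; suc; _∸_; _≡ᵇ_; _≟_)
open import Data.Nat.Properties using (+-comm; +-commutativeSemigroup)
open import Algebra.Properties.CommutativeSemigroup +-commutativeSemigroup using (interchange)
open import Data.Bool using (true; false; if_then_else_; _∧_)
import Data.Bool as Bool
open import Data.List using (List; []; _∷_; _++_; length; filter; map)
open import Data.List.Properties using (map-++; map-∘; map-cong)
open import Data.Nat.ListAction using (sum)
open import Data.Nat.ListAction.Properties using (sum-++)
open import Data.Maybe using (just)
open import Data.Empty using (⊥-elim)
open import Relation.Nullary using (Dec; yes; no; does; ¬_)
open import Relation.Nullary.Decidable using (dec-false)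
open import Relation.Unary using (Pred; Decidable)
open import Relation.Binary.PropositionalEquality
  using (_≗_; refl; cong; cong₂; module ≡-Reasoning)
open ≡-Reasoning

sumSeqs : ℕ → (List Step → ℕ) → ℕ
sumSeqs m g = sum (map g (allSeqs m))

sumSeqs-suc : ∀ m g → sumSeqs (suc m) g ≡ sumSeqs m (g ∘ (U ∷_)) + sumSeqs m (g ∘ (D ∷_))
sumSeqs-suc m g = begin
  sum (map g (map (U ∷_) S ++ map (D ∷_) S))
    ≡⟨ cong sum (map-++ g (map (U ∷_) S) (map (D ∷_) S)) ⟩
  sum (map g (map (U ∷_) S) ++ map g (map (D ∷_) S))
    ≡⟨ sum-++ (map g (map (U ∷_) S)) _ ⟩
  sum (map g (map (U ∷_) S)) + sum (map g (map (D ∷_) S))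
    ≡⟨ cong₂ _+_ (cong sum (map-∘ S)) (cong sum (map-∘ S)) ⟨
  sumSeqs m (g ∘ (U ∷_)) + sumSeqs m (g ∘ (D ∷_)) ∎
  where S = allSeqs m

sumSeqs-cong : ∀ m {f g : List Step → ℕ} → f ≗ g → sumSeqs m f ≡ sumSeqs m g
sumSeqs-cong m f≗g = cong sum (map-cong f≗g (allSeqs m))

peaksAt-U-off : ∀ {k h} s → ¬ (suc h ≡ k) → peaksAt k h (U ∷ s) ≡ peaksAt k (suc h) s
peaksAt-U-off []          _ = refl
peaksAt-U-off (true ∷ s)  _ = refl
peaksAt-U-off {k} {h} (false ∷ s) h+1≢k rewrite dec-false (suc h ≟ k) h+1≢k = refl

valleysAt-D-off : ∀ {k h} s → ¬ (h ∸ 1 ≡ k) → valleysAt k h (D ∷ s) ≡ valleysAt k (h ∸ 1) s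
valleysAt-D-off []          _ = refl
valleysAt-D-off (false ∷ s) _ = refl
valleysAt-D-off {k} {h} (true ∷ s) h-1≢k rewrite dec-false (h ∸ 1 ≟ k) h-1≢k = refl

length-filter-filter : ∀ {a p q} {A : Set a} {P : Pred A p} {Q : Pred A q}
                       (P? : Decidable P) (Q? : Decidable Q) xs →
                       length (filter P? (filter Q? xs))
                         ≡ sum (map (λ x → if does (Q? x) ∧ does (P? x) then 1 else 0) xs)
length-filter-filter P? Q? [] = refl
length-filter-filter P? Q? (x ∷ xs) with does (Q? x)
... | false = length-filter-filter P? Q? xs
... | true with does (P? x)
...   | true  = cong suc (length-filter-filter P? Q? xs)
...   | false = length-filter-filter P? Q? xs

dyckIndicator : (List Step → ℕ) → ℕ → List Step → ℕ
dyckIndicator stat r s = if does (isDyck s Bool.≟ true) ∧ does (stat s ≟ r) then 1 else 0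

isDyck⇒walk : ∀ s → isDyck s ≡ true → walk 0 s ≡ just 0
isDyck⇒walk s dyck with walk 0 s
... | just zero = refl

move : ℕ → Step → ℕ
move h true  = suc h
move h false = h ∸ 1

module PeakValleySwap (j : ℕ) where

  mutual
    swap : ℕ → List Step → List Step
    swap h []      = []
    swap h (x ∷ s) = swap∷ h (h ≟ suc j) x s

    swap∷ : (h : ℕ) → Dec (h ≡ suc j) → Step → List Step → List Step
    swap∷ _ (yes refl) true  (false ∷ s) = D ∷ U ∷ swap (suc j) s
    swap∷ _ (yes refl) false (true ∷ s)  = U ∷ D ∷ swap (suc j) s
    swap∷ h _          x     s           = x ∷ swap (move h x) s

  swap-off : ∀ {h} x s → ¬ (h ≡ suc j) → swap h (x ∷ s) ≡ x ∷ swap (move h x) s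
  swap-off {h} x s h≢j+1 with h ≟ suc j
  ... | yes h≡j+1 = ⊥-elim (h≢j+1 h≡j+1)
  ... | no _      = refl

  move-off : ∀ x → ¬ (move (suc j) x ≡ suc j)
  move-off true  ()
  move-off false ()

  walk-swap : ∀ h s → walk h (swap h s) ≡ walk h s
  walk-swap h []      = refl
  walk-swap h (x ∷ s) with h ≟ suc j
  walk-swap _ (true ∷ false ∷ s)  | yes refl = walk-swap (suc j) s
  walk-swap _ (false ∷ true ∷ s)  | yes refl = walk-swap (suc j) s
  walk-swap _ (true ∷ [])         | yes refl = refl
  walk-swap _ (true ∷ true ∷ s)   | yes refl = walk-swap (suc (suc j)) (true ∷ s)
  walk-swap _ (false ∷ [])        | yes refl = refl
  walk-swap _ (false ∷ false ∷ s) | yes refl = walk-swap j (false ∷ s)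
  walk-swap h       (true ∷ s)    | no _ = walk-swap (suc h) s
  walk-swap zero    (false ∷ s)   | no _ = refl
  walk-swap (suc h) (false ∷ s)   | no _ = walk-swap h s

  isDyck-swap : ∀ s → isDyck (swap 0 s) ≡ isDyck s
  isDyck-swap s rewrite walk-swap 0 s = refl

  -- The hypothesis is needed: peaksAt and valleysAt read a step below the axis
  -- as h ∸ 1 = 0, which would create spurious valleys at height 0.
  valleysAt-swap : ∀ h s {m} → walk h s ≡ just m → valleysAt j h (swap h s) ≡ peaksAt (suc (suc j)) h s
  valleysAt-swap h []      _ = refl
  valleysAt-swap h (x ∷ s) w with h ≟ suc j
  valleysAt-swap _ (true ∷ false ∷ s) w | yes refl =
    cong ((if j ≡ᵇ j then 1 else 0) +_) (valleysAt-swap (suc j) s w)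
  valleysAt-swap _ (false ∷ true ∷ s) w | yes refl = begin
    valleysAt j (suc (suc j)) (D ∷ swap (suc j) s) ≡⟨ valleysAt-D-off (swap (suc j) s) (λ ()) ⟩
    valleysAt j (suc j) (swap (suc j) s)           ≡⟨ valleysAt-swap (suc j) s w ⟩
    peaksAt (suc (suc j)) (suc j) s                ≡⟨ peaksAt-U-off s (λ ()) ⟨
    peaksAt (suc (suc j)) j (U ∷ s)                ∎
  valleysAt-swap _ (true ∷ [])         w | yes refl = refl
  valleysAt-swap _ (true ∷ true ∷ s)   w | yes refl = valleysAt-swap (suc (suc j)) (true ∷ s) w
  valleysAt-swap _ (false ∷ [])        w | yes refl = refl
  valleysAt-swap _ (false ∷ false ∷ s) w | yes refl = begin
    valleysAt j (suc j) (D ∷ swap j (D ∷ s)) ≡⟨ cong (valleysAt j (suc j) ∘ (D ∷_)) (swap-off D s (move-off D)) ⟩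
    valleysAt j j (D ∷ swap (j ∸ 1) s)       ≡⟨ cong (valleysAt j j) (swap-off D s (move-off D)) ⟨
    valleysAt j j (swap j (D ∷ s))           ≡⟨ valleysAt-swap j (false ∷ s) w ⟩
    peaksAt (suc (suc j)) j (D ∷ s)          ∎
  valleysAt-swap h       (true ∷ s)  w | no h≢j+1 = begin
    valleysAt j (suc h) (swap (suc h) s) ≡⟨ valleysAt-swap (suc h) s w ⟩
    peaksAt (suc (suc j)) (suc h) s      ≡⟨ peaksAt-U-off s (h≢j+1 ∘ cong (_∸ 1)) ⟨
    peaksAt (suc (suc j)) h (U ∷ s)      ∎
  valleysAt-swap (suc h) (false ∷ s) w | no h+1≢j+1 = begin
    valleysAt j (suc h) (D ∷ swap h s) ≡⟨ valleysAt-D-off (swap h s) (h+1≢j+1 ∘ cong suc) ⟩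
    valleysAt j h (swap h s)           ≡⟨ valleysAt-swap h s w ⟩
    peaksAt (suc (suc j)) h s          ∎

  mutual
    sumSeqs-swap : ∀ m h g → sumSeqs m (g ∘ swap h) ≡ sumSeqs m g
    sumSeqs-swap zero    h g = refl
    sumSeqs-swap (suc m) h g = begin
      sumSeqs (suc m) (g ∘ swap h)                                       ≡⟨ sumSeqs-suc m (g ∘ swap h) ⟩
      sumSeqs m (g ∘ swap∷ h h≟j+1 U) + sumSeqs m (g ∘ swap∷ h h≟j+1 D) ≡⟨ sumSeqs-swap∷ m h h≟j+1 g ⟩
      sumSeqs m (g ∘ (U ∷_)) + sumSeqs m (g ∘ (D ∷_))                   ≡⟨ sumSeqs-suc m g ⟨
      sumSeqs (suc m) g                                                  ∎
      where h≟j+1 = h ≟ suc j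

    sumSeqs-swap∷ : ∀ m h (h≟j+1 : Dec (h ≡ suc j)) g →
                    sumSeqs m (g ∘ swap∷ h h≟j+1 U) + sumSeqs m (g ∘ swap∷ h h≟j+1 D)
                      ≡ sumSeqs m (g ∘ (U ∷_)) + sumSeqs m (g ∘ (D ∷_))
    sumSeqs-swap∷ m h (no _) g =
      cong₂ _+_ (sumSeqs-swap m (suc h) (g ∘ (U ∷_))) (sumSeqs-swap m (h ∸ 1) (g ∘ (D ∷_)))
    sumSeqs-swap∷ zero    _ (yes refl) g = refl
    sumSeqs-swap∷ (suc m) _ (yes refl) g = begin
      sumSeqs (suc m) (g ∘ swap∷ (suc j) (yes refl) U) + sumSeqs (suc m) (g ∘ swap∷ (suc j) (yes refl) D)
        ≡⟨ cong₂ _+_ (sumSeqs-suc m _) (sumSeqs-suc m _) ⟩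
      (sumSeqs m (λ t → g (U ∷ swap (suc (suc j)) (U ∷ t))) + sumSeqs m (λ t → g (D ∷ U ∷ swap (suc j) t))) +
      (sumSeqs m (λ t → g (U ∷ D ∷ swap (suc j) t)) + sumSeqs m (λ t → g (D ∷ swap j (D ∷ t))))
        ≡⟨ cong₂ _+_ (cong₂ _+_ (unswapped U) (swapped D U)) (cong₂ _+_ (swapped U D) (unswapped D)) ⟩
      (block U U + block D U) + (block U D + block D D)
        ≡⟨ interchange (block U U) (block D U) (block U D) (block D D) ⟩
      (block U U + block U D) + (block D U + block D D)
        ≡⟨ cong₂ _+_ (sumSeqs-suc m _) (sumSeqs-suc m _) ⟨
      sumSeqs (suc m) (g ∘ (U ∷_)) + sumSeqs (suc m) (g ∘ (D ∷_)) ∎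
      where
        block : Step → Step → ℕ
        block x y = sumSeqs m (λ t → g (x ∷ y ∷ t))

        swapped : ∀ x y → sumSeqs m (λ t → g (x ∷ y ∷ swap (suc j) t)) ≡ block x y
        swapped x y = sumSeqs-swap m (suc j) (λ t → g (x ∷ y ∷ t))

        unswapped : ∀ x → sumSeqs m (λ t → g (x ∷ swap (move (suc j) x) (x ∷ t))) ≡ block x x
        unswapped x = begin
          sumSeqs m (λ t → g (x ∷ swap (move (suc j) x) (x ∷ t)))
            ≡⟨ sumSeqs-cong m (λ t → cong (g ∘ (x ∷_)) (swap-off x t (move-off x))) ⟩
          sumSeqs m (λ t → g (x ∷ x ∷ swap (move (move (suc j) x) x) t))
            ≡⟨ sumSeqs-swap m (move (move (suc j) x) x) (λ t → g (x ∷ x ∷ t)) ⟩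
          block x x ∎

  dyckIndicator-swap : ∀ r s → dyckIndicator (valleysAt j 0) r (swap 0 s) ≡ dyckIndicator (peaksAt (suc (suc j)) 0) r s
  dyckIndicator-swap r s rewrite isDyck-swap s with isDyck s in dyck
  ... | false = refl
  ... | true rewrite valleysAt-swap 0 s (isDyck⇒walk s dyck) = refl

open PeakValleySwap

mainTheorem1 : (j r n : ℕ) → peak (j + 2) r n ≡ valley j r n
mainTheorem1 j r n = begin
  peak (j + 2) r n                                                ≡⟨ cong (λ k → peak k r n) (+-comm j 2) ⟩
  peak (suc (suc j)) r n                                          ≡⟨ length-filter-filter _ _ (allSeqs (n + n)) ⟩
  sumSeqs (n + n) (dyckIndicator (peaksAt (suc (suc j)) 0) r)     ≡⟨ sumSeqs-cong (n + n) (dyckIndicator-swap j r) ⟨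
  sumSeqs (n + n) (dyckIndicator (valleysAt j 0) r ∘ swap j 0)    ≡⟨ sumSeqs-swap j (n + n) 0 _ ⟩
  sumSeqs (n + n) (dyckIndicator (valleysAt j 0) r)               ≡⟨ length-filter-filter _ _ (allSeqs (n + n)) ⟨
  valley j r n                                                    ∎
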